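{- Let $m\ge 2$ be an integer. Then $$1+\sum_{n=1}^{\infty}\sum_{j=1}^{m-1}\frac{q^{mn-j}}{\left(\prod_{r=1}^{m-j}(q^r;q^m)_n\right)\cdot\left(\prod_{r=m-j+1}^{m-1}(q^r;q^m)_{n-1}\right)}=\frac{(q^m;q^m)_{\infty}}{(q;q)_{\infty}}.$$
   Context: For a complex $A$ and integer $K\ge 0$, $(A;q)_K=\prod_{i=0}^{K-1}(1-Aq^i)$, with $(A;q)_0=1$, and $(A;q)_\infty=\lim_{K\to\infty}(A;q)_K$; the identity is of formal power series in $q$ (equivalently, analytic for $|q|<1$). An empty product equals $1$. -}

module Defs where

open import Data.Nat using (ℕ; zero; suc; _∸_; _≤_; _≟_)
open import Data.Integer using (ℤ; +_; -_) renaming (_+_ to _+ℤ_; _*_ to _*ℤ_; _-_ to _-ℤ_)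
open import Data.List using (List; []; _∷_)
open import Data.Product using (∃)
open import Relation.Nullary using (yes; no)
open import Relation.Binary.PropositionalEquality using (_≡_)

-- Formal power series in q with integer coefficients: n ↦ coefficient of q^n.
FPS : Set
FPS = ℕ → ℤ

sumℤ : ℕ → (ℕ → ℤ) → ℤ
sumℤ zero    f = + 0
sumℤ (suc n) f = sumℤ n f +ℤ f n

mono : ℕ → FPS
mono k n with n ≟ k
... | yes _ = + 1
... | no  _ = + 0

oneₛ : FPS
oneₛ = mono 0

infixl 6 _+ₛ_ _-ₛ_
infixl 7 _*ₛ_

_+ₛ_ : FPS → FPS → FPS
(f +ₛ g) n = f n +ℤ g n

_-ₛ_ : FPS → FPS → FPS
(f -ₛ g) n = f n -ℤ g n

_*ₛ_ : FPS → FPS → FPS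
(f *ₛ g) n = sumℤ (suc n) (λ i → f i *ℤ g (n ∸ i))

powₛ : FPS → ℕ → FPS
powₛ f zero    = oneₛ
powₛ f (suc k) = powₛ f k *ₛ f

sumₛ : ℕ → (ℕ → FPS) → FPS
sumₛ zero    F = λ _ → + 0
sumₛ (suc n) F = sumₛ n F +ₛ F n

prodₛ : ℕ → (ℕ → FPS) → FPS
prodₛ zero    F = oneₛ
prodₛ (suc n) F = prodₛ n F *ₛ F n

poch : FPS → FPS → ℕ → FPS
poch A Q K = prodₛ K (λ i → oneₛ -ₛ A *ₛ powₛ Q i)

-- Multiplicative inverse of a series f with constant term 1:
-- b_0 = 1, b_n = - Σ_{i=1}^{n} f_i b_{n-i}.
-- invUpTo f n = [b_n, b_{n-1}, ..., b_0].
private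
  nth : List ℤ → ℕ → ℤ
  nth []       _       = + 0
  nth (x ∷ xs) zero    = x
  nth (x ∷ xs) (suc k) = nth xs k

invUpTo : FPS → ℕ → List ℤ
invUpTo f zero    = + 1 ∷ []
invUpTo f (suc n) =
  let bs = invUpTo f n in
  (- sumℤ (suc n) (λ k → f (suc k) *ℤ nth bs k)) ∷ bs

inv : FPS → FPS
inv f n with invUpTo f n
... | []    = + 0
... | b ∷ _ = b

-- Convergence of a sequence of formal power series (coefficientwise
-- eventual stabilisation, i.e. the q-adic / formal topology).
Tendsto : (ℕ → FPS) → FPS → Set
Tendsto s L = ∀ N → ∃ λ K → ∀ k → K ≤ k → s k N ≡ L N

-- The summand for given m, n ≥ 1, 1 ≤ j ≤ m-1:
-- q^{mn-j} / ( ∏_{r=1}^{m-j} (q^r;q^m)_n · ∏_{r=m-j+1}^{m-1} (q^r;q^m)_{n-1} )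
term : ℕ → ℕ → ℕ → FPS
term m n j =
  mono (m Data.Nat.* n ∸ j) *ₛ
  inv ( prodₛ (m ∸ j) (λ i → poch (mono (suc i)) (mono m) n)
        *ₛ prodₛ (j ∸ 1) (λ i → poch (mono (m ∸ j Data.Nat.+ suc i)) (mono m) (n ∸ 1)) )

partialLHS : ℕ → ℕ → FPS
partialLHS m K = oneₛ +ₛ sumₛ K (λ n′ → sumₛ (m ∸ 1) (λ j′ → term m (suc n′) (suc j′)))

{-# OPTIONS --safe #-}
module Submission where

-- Write D_n = ∏_{r=1}^{m-1} (q^r;q^m)_n. The m - 1 summands of the n-th block have as
-- denominators the products obtained from D_{n-1} by raising the factors (q^r;q^m)_{n-1}
-- to (q^r;q^m)_n one r at a time, and q^e/X = 1/X - 1/Y whenever X = Y (1 - q^e). So each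
-- block telescopes to 1/D_n - 1/D_{n-1}, and the K-th partial sum is 1/D_K. Sorting the
-- factors 1 - q^k of (q;q)_{mK} by k modulo m gives D_K (q^m;q^m)_K = (q;q)_{mK}, so the
-- partial sum is (q^m;q^m)_K / (q;q)_{mK}; coefficientwise limits commute with products
-- and with reciprocals of series with constant term 1.

open import Defs
open import Level using (0ℓ)
open import Algebra.Bundles using (CommutativeMonoid)
import Algebra.Solver.CommutativeMonoid
open import Data.Nat using (ℕ; zero; suc; _∸_; _≤_; _<_; z≤n; s≤s; _≟_; _⊔_)
  renaming (_+_ to _+ℕ_; _*_ to _*ℕ_)
import Data.Nat.Properties as ℕ
open import Data.Integer using (ℤ; +_; -_)
  renaming (_+_ to _+ℤ_; _*_ to _*ℤ_; _-_ to _-ℤ_)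
import Data.Integer.Properties as ℤ
open import Data.Integer.Solver using (module +-*-Solver)
open import Data.List using (List)
open import Data.Product using (∃; _×_; _,_)
open import Data.Sum using (inj₁; inj₂)
open import Function using (_∘_)
open import Relation.Nullary using (yes; no; contradiction)
open import Relation.Binary.Structures using (IsEquivalence)
open import Relation.Binary.PropositionalEquality
import Relation.Binary.Reasoning.Setoid as SetoidReasoning

-- Finite sums of integers

sumℤ-cong : ∀ n {f g : ℕ → ℤ} → (∀ k → k < n → f k ≡ g k) → sumℤ n f ≡ sumℤ n g
sumℤ-cong zero    f≡g = refl
sumℤ-cong (suc n) f≡g =
  cong₂ _+ℤ_ (sumℤ-cong n (λ k k<n → f≡g k (ℕ.m<n⇒m<1+n k<n))) (f≡g n ℕ.≤-refl)

sumℤ-zero : ∀ n {f : ℕ → ℤ} → (∀ k → k < n → f k ≡ + 0) → sumℤ n f ≡ + 0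
sumℤ-zero zero    f≡0 = refl
sumℤ-zero (suc n) f≡0 =
  cong₂ _+ℤ_ (sumℤ-zero n (λ k k<n → f≡0 k (ℕ.m<n⇒m<1+n k<n))) (f≡0 n ℕ.≤-refl)

sumℤ-head : ∀ n (f : ℕ → ℤ) → sumℤ (suc n) f ≡ f 0 +ℤ sumℤ n (f ∘ suc)
sumℤ-head zero    f = trans (ℤ.+-identityˡ (f 0)) (sym (ℤ.+-identityʳ (f 0)))
sumℤ-head (suc n) f = trans (cong (_+ℤ f (suc n)) (sumℤ-head n f)) (ℤ.+-assoc (f 0) _ _)

sumℤ-distrib-+ : ∀ n (f g : ℕ → ℤ) →
  sumℤ n (λ k → f k +ℤ g k) ≡ sumℤ n f +ℤ sumℤ n g
sumℤ-distrib-+ zero    f g = refl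
sumℤ-distrib-+ (suc n) f g =
  trans (cong (_+ℤ (f n +ℤ g n)) (sumℤ-distrib-+ n f g))
        (solve 4 (λ a b c d → (a :+ b) :+ (c :+ d) := (a :+ c) :+ (b :+ d)) refl
               (sumℤ n f) (sumℤ n g) (f n) (g n))
  where open +-*-Solver

*-distribˡ-sumℤ : ∀ n c (f : ℕ → ℤ) → c *ℤ sumℤ n f ≡ sumℤ n (λ k → c *ℤ f k)
*-distribˡ-sumℤ zero    c f = ℤ.*-zeroʳ c
*-distribˡ-sumℤ (suc n) c f =
  trans (ℤ.*-distribˡ-+ c (sumℤ n f) (f n)) (cong (_+ℤ c *ℤ f n) (*-distribˡ-sumℤ n c f))

*-distribʳ-sumℤ : ∀ n c (f : ℕ → ℤ) → sumℤ n f *ℤ c ≡ sumℤ n (λ k → f k *ℤ c)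
*-distribʳ-sumℤ n c f =
  trans (ℤ.*-comm (sumℤ n f) c)
        (trans (*-distribˡ-sumℤ n c f) (sumℤ-cong n (λ k _ → ℤ.*-comm c (f k))))

antidiag : (ℕ → ℕ → ℤ) → ℕ → ℤ
antidiag F n = sumℤ (suc n) (λ i → F i (n ∸ i))

antidiag-cong : ∀ {F G : ℕ → ℕ → ℤ} n → (∀ i j → F i j ≡ G i j) →
  antidiag F n ≡ antidiag G n
antidiag-cong n F≡G = sumℤ-cong (suc n) (λ i _ → F≡G i _)

antidiag-sucˡ : ∀ (F : ℕ → ℕ → ℤ) n →
  antidiag F (suc n) ≡ F 0 (suc n) +ℤ antidiag (F ∘ suc) n
antidiag-sucˡ F n = sumℤ-head (suc n) (λ i → F i (suc n ∸ i))

antidiag-sucʳ : ∀ (F : ℕ → ℕ → ℤ) n →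
  antidiag F (suc n) ≡ antidiag (λ i j → F i (suc j)) n +ℤ F (suc n) 0
antidiag-sucʳ F n =
  cong₂ _+ℤ_
    (sumℤ-cong (suc n) (λ i i<1+n → cong (F i) (ℕ.+-∸-assoc 1 (ℕ.≤-pred i<1+n))))
    (cong (F (suc n)) (ℕ.n∸n≡0 n))

antidiag-swap : ∀ (F : ℕ → ℕ → ℤ) n → antidiag F n ≡ antidiag (λ i j → F j i) n
antidiag-swap F zero    = refl
antidiag-swap F (suc n) = begin
  antidiag F (suc n)                               ≡⟨ antidiag-sucˡ F n ⟩
  F 0 (suc n) +ℤ antidiag (F ∘ suc) n              ≡⟨ cong (F 0 (suc n) +ℤ_)
                                                           (antidiag-swap (F ∘ suc) n) ⟩
  F 0 (suc n) +ℤ antidiag (λ i j → F (suc j) i) n  ≡⟨ ℤ.+-comm (F 0 (suc n)) _ ⟩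
  antidiag (λ i j → F (suc j) i) n +ℤ F 0 (suc n)  ≡⟨ antidiag-sucʳ (λ i j → F j i) n ⟨
  antidiag (λ i j → F j i) (suc n)                 ∎
  where open ≡-Reasoning

-- Both sides sum F a b c over a + b + c = n; the induction splits off the terms with a = 0.
antidiag-assoc : ∀ (F : ℕ → ℕ → ℕ → ℤ) n →
  antidiag (λ i c → antidiag (λ a b → F a b c) i) n ≡
  antidiag (λ a j → antidiag (λ b c → F a b c) j) n
antidiag-assoc F zero    = refl
antidiag-assoc F (suc n) = begin
  antidiag (λ i c → antidiag (λ a b → F a b c) i) (suc n)
    ≡⟨ antidiag-sucˡ (λ i c → antidiag (λ a b → F a b c) i) n ⟩
  antidiag (λ a b → F a b (suc n)) 0 +ℤ antidiag (λ i c → antidiag (λ a b → F a b c) (suc i)) n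
    ≡⟨ cong (antidiag (λ a b → F a b (suc n)) 0 +ℤ_)
            (trans (antidiag-cong n (λ i c → antidiag-sucˡ (λ a b → F a b c) i))
                   (sumℤ-distrib-+ (suc n) _ _)) ⟩
  (+ 0 +ℤ F 0 0 (suc n)) +ℤ (X +ℤ antidiag (λ i c → antidiag (λ a b → F (suc a) b c) i) n)
    ≡⟨ cong (λ z → (+ 0 +ℤ F 0 0 (suc n)) +ℤ (X +ℤ z)) (antidiag-assoc (F ∘ suc) n) ⟩
  (+ 0 +ℤ F 0 0 (suc n)) +ℤ (X +ℤ Y)
    ≡⟨ solve 3 (λ a x y → (con (+ 0) :+ a) :+ (x :+ y) := (a :+ x) :+ y) refl
               (F 0 0 (suc n)) X Y ⟩
  (F 0 0 (suc n) +ℤ X) +ℤ Y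
    ≡⟨ cong (_+ℤ Y) (antidiag-sucˡ (F 0) n) ⟨
  antidiag (F 0) (suc n) +ℤ Y
    ≡⟨ antidiag-sucˡ (λ a j → antidiag (λ b c → F a b c) j) n ⟨
  antidiag (λ a j → antidiag (λ b c → F a b c) j) (suc n)
    ∎
  where
  open ≡-Reasoning
  open +-*-Solver
  X = antidiag (λ i c → F 0 (suc i) c) n
  Y = antidiag (λ a j → antidiag (λ b c → F (suc a) b c) j) n

-- Arithmetic of formal power series

-- Coefficientwise equality, wrapped in a record so that both series are inferable from it.
infix 4 _≋_
record _≋_ (f g : FPS) : Set where
  constructor mk≋
  field coeff≡ : ∀ n → f n ≡ g n
open _≋_

≋-isEquivalence : IsEquivalence _≋_
≋-isEquivalence = record
  { refl  = mk≋ λ _ → refl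
  ; sym   = λ f≋g → mk≋ λ n → sym (f≋g .coeff≡ n)
  ; trans = λ f≋g g≋h → mk≋ λ n → trans (f≋g .coeff≡ n) (g≋h .coeff≡ n)
  }

open IsEquivalence ≋-isEquivalence
  using () renaming (refl to ≋-refl; sym to ≋-sym; trans to ≋-trans)

≡⇒≋ : ∀ {f g} → f ≡ g → f ≋ g
≡⇒≋ refl = ≋-refl

+ₛ-cong : ∀ {f f′ g g′} → f ≋ f′ → g ≋ g′ → f +ₛ g ≋ f′ +ₛ g′
+ₛ-cong f≋f′ g≋g′ .coeff≡ n = cong₂ _+ℤ_ (f≋f′ .coeff≡ n) (g≋g′ .coeff≡ n)

+ₛ-assoc : ∀ f g h → (f +ₛ g) +ₛ h ≋ f +ₛ (g +ₛ h)
+ₛ-assoc f g h .coeff≡ n = ℤ.+-assoc (f n) (g n) (h n)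

+ₛ-comm : ∀ f g → f +ₛ g ≋ g +ₛ f
+ₛ-comm f g .coeff≡ n = ℤ.+-comm (f n) (g n)

*ₛ-cong : ∀ {f f′ g g′} → f ≋ f′ → g ≋ g′ → f *ₛ g ≋ f′ *ₛ g′
*ₛ-cong f≋f′ g≋g′ .coeff≡ n =
  sumℤ-cong (suc n) (λ i _ → cong₂ _*ℤ_ (f≋f′ .coeff≡ i) (g≋g′ .coeff≡ (n ∸ i)))

*ₛ-congˡ : ∀ f {g g′} → g ≋ g′ → f *ₛ g ≋ f *ₛ g′
*ₛ-congˡ f = *ₛ-cong (≋-refl {f})

*ₛ-congʳ : ∀ g {f f′} → f ≋ f′ → f *ₛ g ≋ f′ *ₛ g
*ₛ-congʳ g f≋f′ = *ₛ-cong f≋f′ (≋-refl {g})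

*ₛ-comm : ∀ f g → f *ₛ g ≋ g *ₛ f
*ₛ-comm f g .coeff≡ n =
  trans (antidiag-swap (λ i j → f i *ℤ g j) n)
        (antidiag-cong n (λ i j → ℤ.*-comm (f j) (g i)))

*ₛ-assoc : ∀ f g h → (f *ₛ g) *ₛ h ≋ f *ₛ (g *ₛ h)
*ₛ-assoc f g h .coeff≡ n = begin
  antidiag (λ i c → antidiag (λ a b → f a *ℤ g b) i *ℤ h c) n
    ≡⟨ antidiag-cong n (λ i c → *-distribʳ-sumℤ (suc i) (h c) (λ a → f a *ℤ g (i ∸ a))) ⟩
  antidiag (λ i c → antidiag (λ a b → f a *ℤ g b *ℤ h c) i) n
    ≡⟨ antidiag-assoc (λ a b c → f a *ℤ g b *ℤ h c) n ⟩
  antidiag (λ a j → antidiag (λ b c → f a *ℤ g b *ℤ h c) j) n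
    ≡⟨ antidiag-cong n (λ a j →
         trans (sumℤ-cong (suc j) (λ b _ → ℤ.*-assoc (f a) (g b) _))
               (sym (*-distribˡ-sumℤ (suc j) (f a) (λ b → g b *ℤ h (j ∸ b))))) ⟩
  antidiag (λ a j → f a *ℤ antidiag (λ b c → g b *ℤ h c) j) n
    ∎
  where open ≡-Reasoning

*ₛ-distribʳ-+ₛ : ∀ f g h → (f +ₛ g) *ₛ h ≋ f *ₛ h +ₛ g *ₛ h
*ₛ-distribʳ-+ₛ f g h .coeff≡ n =
  trans (sumℤ-cong (suc n) (λ i _ → ℤ.*-distribʳ-+ (h (n ∸ i)) (f i) (g i)))
        (sumℤ-distrib-+ (suc n) _ _)

*ₛ-constant : ∀ f g → (f *ₛ g) 0 ≡ f 0 *ℤ g 0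
*ₛ-constant f g = ℤ.+-identityˡ _

mono-≡ : ∀ {k n} → n ≡ k → mono k n ≡ + 1
mono-≡ {k} {n} n≡k with n ≟ k
... | yes _   = refl
... | no n≢k = contradiction n≡k n≢k

mono-≢ : ∀ {k n} → n ≢ k → mono k n ≡ + 0
mono-≢ {k} {n} n≢k with n ≟ k
... | yes n≡k = contradiction n≡k n≢k
... | no _    = refl

mono-suc : ∀ k n → mono (suc k) (suc n) ≡ mono k n
mono-suc k n with n ≟ k
... | yes n≡k = mono-≡ (cong suc n≡k)
... | no n≢k  = mono-≢ (n≢k ∘ ℕ.suc-injective)

*ₛ-identityˡ : ∀ f → oneₛ *ₛ f ≋ f
*ₛ-identityˡ f .coeff≡ zero    = trans (ℤ.+-identityˡ _) (ℤ.*-identityˡ (f 0))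
*ₛ-identityˡ f .coeff≡ (suc n) = begin
  (oneₛ *ₛ f) (suc n)
    ≡⟨ antidiag-sucˡ (λ i j → oneₛ i *ℤ f j) n ⟩
  + 1 *ℤ f (suc n) +ℤ antidiag (λ i j → oneₛ (suc i) *ℤ f j) n
    ≡⟨ cong₂ _+ℤ_ (ℤ.*-identityˡ (f (suc n))) (sumℤ-zero (suc n) (λ _ _ → refl)) ⟩
  f (suc n) +ℤ + 0
    ≡⟨ ℤ.+-identityʳ _ ⟩
  f (suc n)
    ∎
  where open ≡-Reasoning

*ₛ-identityʳ : ∀ f → f *ₛ oneₛ ≋ f
*ₛ-identityʳ f = ≋-trans (*ₛ-comm f oneₛ) (*ₛ-identityˡ f)

*ₛ-commutativeMonoid : CommutativeMonoid 0ℓ 0ℓ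
*ₛ-commutativeMonoid = record
  { Carrier             = FPS
  ; _≈_                 = _≋_
  ; _∙_                 = _*ₛ_
  ; ε                   = oneₛ
  ; isCommutativeMonoid = record
    { isMonoid = record
      { isSemigroup = record
        { isMagma = record { isEquivalence = ≋-isEquivalence ; ∙-cong = *ₛ-cong }
        ; assoc   = *ₛ-assoc
        }
      ; identity = *ₛ-identityˡ , *ₛ-identityʳ
      }
    ; comm = *ₛ-comm
    }
  }

module *ₛ-Solver = Algebra.Solver.CommutativeMonoid *ₛ-commutativeMonoid
module ≋-Reasoning = SetoidReasoning (CommutativeMonoid.setoid *ₛ-commutativeMonoid)

mono-suc-*ₛ : ∀ k f n → (mono (suc k) *ₛ f) (suc n) ≡ (mono k *ₛ f) n
mono-suc-*ₛ k f n =
  trans (antidiag-sucˡ (λ i j → mono (suc k) i *ℤ f j) n)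
        (trans (cong (+ 0 +ℤ_) (antidiag-cong n (λ i j → cong (_*ℤ f j) (mono-suc k i))))
               (ℤ.+-identityˡ _))

mono-*ₛ-mono : ∀ a b → mono a *ₛ mono b ≋ mono (a +ℕ b)
mono-*ₛ-mono zero    b .coeff≡ n       = *ₛ-identityˡ (mono b) .coeff≡ n
mono-*ₛ-mono (suc a) b .coeff≡ zero    = refl
mono-*ₛ-mono (suc a) b .coeff≡ (suc n) =
  trans (mono-suc-*ₛ a (mono b) n)
        (trans (mono-*ₛ-mono a b .coeff≡ n) (sym (mono-suc (a +ℕ b) n)))

powₛ-mono : ∀ b i → powₛ (mono b) i ≋ mono (b *ℕ i)
powₛ-mono b zero    = ≡⇒≋ (cong mono (sym (ℕ.*-zeroʳ b)))
powₛ-mono b (suc i) = begin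
  powₛ (mono b) i *ₛ mono b  ≈⟨ *ₛ-congʳ (mono b) (powₛ-mono b i) ⟩
  mono (b *ℕ i) *ₛ mono b    ≈⟨ mono-*ₛ-mono (b *ℕ i) b ⟩
  mono (b *ℕ i +ℕ b)         ≈⟨ ≡⇒≋ (cong mono (trans (ℕ.+-comm (b *ℕ i) b)
                                                       (sym (ℕ.*-suc b i)))) ⟩
  mono (b *ℕ suc i)          ∎
  where open ≋-Reasoning

1-q^_ : ℕ → FPS
1-q^ a = oneₛ -ₛ mono a

mono+1-q^≋one : ∀ a → mono a +ₛ 1-q^ a ≋ oneₛ
mono+1-q^≋one a .coeff≡ n = solve 2 (λ x y → y :+ (x :+ :- y) := x) refl (oneₛ n) (mono a n)
  where open +-*-Solver

-- Reciprocals

-- Defs keeps the list lookup behind inv private; the underscore is solved to it by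
-- unification, once invUpTo f n is abstracted in the unfolding of inv f (suc n).
mutual
  lookupInv : List ℤ → ℕ → ℤ
  lookupInv = _

  inv-suc-unfold : ∀ f n →
    inv f (suc n) ≡ - sumℤ (suc n) (λ k → f (suc k) *ℤ lookupInv (invUpTo f n) k)
  inv-suc-unfold f n with invUpTo f n
  ... | _ = refl

lookupInv-invUpTo : ∀ f n k → k ≤ n → lookupInv (invUpTo f n) k ≡ inv f (n ∸ k)
lookupInv-invUpTo f zero    zero    _         = refl
lookupInv-invUpTo f (suc n) zero    _         = refl
lookupInv-invUpTo f (suc n) (suc k) (s≤s k≤n) = lookupInv-invUpTo f n k k≤n

inv-suc : ∀ f n → inv f (suc n) ≡ - sumℤ (suc n) (λ k → f (suc k) *ℤ inv f (n ∸ k))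
inv-suc f n =
  trans (inv-suc-unfold f n)
        (cong -_ (sumℤ-cong (suc n) (λ k k<1+n →
          cong (f (suc k) *ℤ_) (lookupInv-invUpTo f n k (ℕ.≤-pred k<1+n)))))

*ₛ-inverseʳ : ∀ f → f 0 ≡ + 1 → f *ₛ inv f ≋ oneₛ
*ₛ-inverseʳ f f₀≡1 .coeff≡ zero    = trans (*ₛ-constant f (inv f)) (cong (_*ℤ + 1) f₀≡1)
*ₛ-inverseʳ f f₀≡1 .coeff≡ (suc n) = begin
  (f *ₛ inv f) (suc n)           ≡⟨ antidiag-sucˡ (λ i j → f i *ℤ inv f j) n ⟩
  f 0 *ℤ inv f (suc n) +ℤ S      ≡⟨ cong₂ (λ a b → a *ℤ b +ℤ S) f₀≡1 (inv-suc f n) ⟩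
  + 1 *ℤ (- S) +ℤ S              ≡⟨ cong (_+ℤ S) (ℤ.*-identityˡ (- S)) ⟩
  - S +ℤ S                       ≡⟨ ℤ.+-inverseˡ S ⟩
  + 0                            ∎
  where
  open ≡-Reasoning
  S = antidiag (λ i j → f (suc i) *ℤ inv f j) n

inv-unique : ∀ f g → f 0 ≡ + 1 → f *ₛ g ≋ oneₛ → g ≋ inv f
inv-unique f g f₀≡1 fg≋1 = begin
  g                    ≈⟨ *ₛ-identityʳ g ⟨
  g *ₛ oneₛ            ≈⟨ *ₛ-congˡ g (*ₛ-inverseʳ f f₀≡1) ⟨
  g *ₛ (f *ₛ inv f)    ≈⟨ *ₛ-assoc g f (inv f) ⟨
  (g *ₛ f) *ₛ inv f    ≈⟨ *ₛ-congʳ (inv f) (≋-trans (*ₛ-comm g f) fg≋1) ⟩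
  oneₛ *ₛ inv f        ≈⟨ *ₛ-identityˡ (inv f) ⟩
  inv f                ∎
  where open ≋-Reasoning

f*g≋h⇒inv-f≋g*inv-h : ∀ f g h → f 0 ≡ + 1 → h 0 ≡ + 1 → f *ₛ g ≋ h →
  inv f ≋ g *ₛ inv h
f*g≋h⇒inv-f≋g*inv-h f g h f₀≡1 h₀≡1 fg≋h =
  ≋-sym (inv-unique f (g *ₛ inv h) f₀≡1 f*[g*inv-h]≋1)
  where
  open ≋-Reasoning
  f*[g*inv-h]≋1 : f *ₛ (g *ₛ inv h) ≋ oneₛ
  f*[g*inv-h]≋1 = begin
    f *ₛ (g *ₛ inv h)    ≈⟨ *ₛ-assoc f g (inv h) ⟨
    (f *ₛ g) *ₛ inv h    ≈⟨ *ₛ-congʳ (inv h) fg≋h ⟩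
    h *ₛ inv h           ≈⟨ *ₛ-inverseʳ h h₀≡1 ⟩
    oneₛ                 ∎

inv-one : inv oneₛ ≋ oneₛ
inv-one = ≋-sym (inv-unique oneₛ oneₛ refl (*ₛ-identityˡ oneₛ))

AgreeUpTo : ℕ → FPS → FPS → Set
AgreeUpTo N f g = ∀ i → i ≤ N → f i ≡ g i

agree-pred : ∀ {N f g} → AgreeUpTo (suc N) f g → AgreeUpTo N f g
agree-pred f≈g i i≤N = f≈g i (ℕ.m≤n⇒m≤1+n i≤N)

agree-suc : ∀ {N f g} → AgreeUpTo N f g → f (suc N) ≡ g (suc N) → AgreeUpTo (suc N) f g
agree-suc f≈g eq i i≤1+N with ℕ.m≤n⇒m<n∨m≡n i≤1+N
... | inj₁ i<1+N = f≈g i (ℕ.≤-pred i<1+N)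
... | inj₂ refl  = eq

*ₛ-agree : ∀ {N f f′ g g′} → AgreeUpTo N f f′ → AgreeUpTo N g g′ →
  AgreeUpTo N (f *ₛ g) (f′ *ₛ g′)
*ₛ-agree f≈f′ g≈g′ i i≤N = sumℤ-cong (suc i) (λ j j<1+i →
  cong₂ _*ℤ_ (f≈f′ j (ℕ.≤-trans (ℕ.≤-pred j<1+i) i≤N))
             (g≈g′ (i ∸ j) (ℕ.≤-trans (ℕ.m∸n≤m i j) i≤N)))

inv-agree : ∀ N {f g} → AgreeUpTo N f g → AgreeUpTo N (inv f) (inv g)
inv-agree zero            f≈g zero _ = refl
inv-agree (suc N) {f} {g} f≈g = agree-suc (inv-agree N (agree-pred f≈g)) (begin
  inv f (suc N)                                      ≡⟨ inv-suc f N ⟩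
  - sumℤ (suc N) (λ k → f (suc k) *ℤ inv f (N ∸ k))  ≡⟨ cong -_ (sumℤ-cong _ summand≡) ⟩
  - sumℤ (suc N) (λ k → g (suc k) *ℤ inv g (N ∸ k))  ≡⟨ inv-suc g N ⟨
  inv g (suc N)                                      ∎)
  where
  open ≡-Reasoning
  summand≡ : ∀ k → k < suc N → f (suc k) *ℤ inv f (N ∸ k) ≡ g (suc k) *ℤ inv g (N ∸ k)
  summand≡ k k<1+N = cong₂ _*ℤ_ (f≈g (suc k) k<1+N)
                                (inv-agree N (agree-pred f≈g) (N ∸ k) (ℕ.m∸n≤m N k))

inv-cong : ∀ {f g} → f ≋ g → inv f ≋ inv g
inv-cong f≋g .coeff≡ n = inv-agree n (λ i _ → f≋g .coeff≡ i) n ℕ.≤-refl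

-- Coefficientwise limits

Eventually : (ℕ → Set) → Set
Eventually P = ∃ λ K → ∀ k → K ≤ k → P k

eventually-map : ∀ {P Q : ℕ → Set} → (∀ {k} → P k → Q k) → Eventually P → Eventually Q
eventually-map P⇒Q (K , p) = K , λ k K≤k → P⇒Q (p k K≤k)

eventually-× : ∀ {P Q : ℕ → Set} → Eventually P → Eventually Q →
  Eventually (λ k → P k × Q k)
eventually-× (K , p) (K′ , q) =
  K ⊔ K′ , λ k K⊔K′≤k → p k (ℕ.≤-trans (ℕ.m≤m⊔n K K′) K⊔K′≤k)
                      , q k (ℕ.≤-trans (ℕ.m≤n⊔m K K′) K⊔K′≤k)

tendsto-agree : ∀ {s L} → Tendsto s L → ∀ N → Eventually (λ k → AgreeUpTo N (s k) L)
tendsto-agree s→L zero    = eventually-map (λ { eq .zero z≤n → eq }) (s→L 0)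
tendsto-agree s→L (suc N) =
  eventually-map (λ (agree , eq) → agree-suc agree eq)
                 (eventually-× (tendsto-agree s→L N) (s→L (suc N)))

tendsto-cong : ∀ {s t L} → (∀ k → s k ≋ t k) → Tendsto s L → Tendsto t L
tendsto-cong s≋t s→L N =
  eventually-map (λ {k} eq → trans (sym (s≋t k .coeff≡ N)) eq) (s→L N)

tendsto-reindex : ∀ {s L} (r : ℕ → ℕ) → (∀ k → k ≤ r k) → Tendsto s L →
  Tendsto (s ∘ r) L
tendsto-reindex r k≤rk s→L N =
  let K , eq = s→L N in K , λ k K≤k → eq (r k) (ℕ.≤-trans K≤k (k≤rk k))

tendsto-*ₛ : ∀ {s t a b} → Tendsto s a → Tendsto t b → Tendsto (λ k → s k *ₛ t k) (a *ₛ b)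
tendsto-*ₛ s→a t→b N =
  eventually-map (λ (s≈a , t≈b) → *ₛ-agree s≈a t≈b N ℕ.≤-refl)
                 (eventually-× (tendsto-agree s→a N) (tendsto-agree t→b N))

tendsto-inv : ∀ {s a} → Tendsto s a → Tendsto (inv ∘ s) (inv a)
tendsto-inv s→a N =
  eventually-map (λ s≈a → inv-agree N s≈a N ℕ.≤-refl) (tendsto-agree s→a N)

-- Finite products and q-Pochhammer symbols

sumₛ-cong : ∀ n {F G : ℕ → FPS} → (∀ i → i < n → F i ≋ G i) → sumₛ n F ≋ sumₛ n G
sumₛ-cong zero    F≋G = ≋-refl
sumₛ-cong (suc n) F≋G =
  +ₛ-cong (sumₛ-cong n (λ i i<n → F≋G i (ℕ.m<n⇒m<1+n i<n))) (F≋G n ℕ.≤-refl)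

prodₛ-cong : ∀ n {F G : ℕ → FPS} → (∀ i → F i ≋ G i) → prodₛ n F ≋ prodₛ n G
prodₛ-cong zero    F≋G = ≋-refl
prodₛ-cong (suc n) F≋G = *ₛ-cong (prodₛ-cong n F≋G) (F≋G n)

prodₛ-one : ∀ n → prodₛ n (λ _ → oneₛ) ≋ oneₛ
prodₛ-one zero    = ≋-refl
prodₛ-one (suc n) = ≋-trans (*ₛ-identityʳ _) (prodₛ-one n)

prodₛ-constant : ∀ n {F : ℕ → FPS} → (∀ i → F i 0 ≡ + 1) → prodₛ n F 0 ≡ + 1
prodₛ-constant zero    F₀≡1 = refl
prodₛ-constant (suc n) {F} F₀≡1 =
  trans (*ₛ-constant (prodₛ n F) (F n)) (cong₂ _*ℤ_ (prodₛ-constant n F₀≡1) (F₀≡1 n))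

prodₛ-distrib : ∀ n (F G : ℕ → FPS) →
  prodₛ n (λ i → F i *ₛ G i) ≋ prodₛ n F *ₛ prodₛ n G
prodₛ-distrib zero    F G = ≋-sym (*ₛ-identityˡ oneₛ)
prodₛ-distrib (suc n) F G = begin
  prodₛ n (λ i → F i *ₛ G i) *ₛ (F n *ₛ G n)
    ≈⟨ *ₛ-congʳ (F n *ₛ G n) (prodₛ-distrib n F G) ⟩
  (prodₛ n F *ₛ prodₛ n G) *ₛ (F n *ₛ G n)
    ≈⟨ solve 4 (λ a b c d → (a ⊕ b) ⊕ (c ⊕ d) ⊜ (a ⊕ c) ⊕ (b ⊕ d)) ≋-refl
               (prodₛ n F) (prodₛ n G) (F n) (G n) ⟩
  (prodₛ n F *ₛ F n) *ₛ (prodₛ n G *ₛ G n)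
    ∎
  where
  open ≋-Reasoning
  open *ₛ-Solver

prodₛ-+ : ∀ a b (F : ℕ → FPS) →
  prodₛ (a +ℕ b) F ≋ prodₛ a F *ₛ prodₛ b (λ i → F (a +ℕ i))
prodₛ-+ a zero    F =
  ≋-trans (≡⇒≋ (cong (λ n → prodₛ n F) (ℕ.+-identityʳ a)))
          (≋-sym (*ₛ-identityʳ (prodₛ a F)))
prodₛ-+ a (suc b) F = begin
  prodₛ (a +ℕ suc b) F             ≡⟨ cong (λ n → prodₛ n F) (ℕ.+-suc a b) ⟩
  prodₛ (a +ℕ b) F *ₛ F (a +ℕ b)   ≈⟨ *ₛ-congʳ (F (a +ℕ b)) (prodₛ-+ a b F) ⟩
  (prodₛ a F *ₛ G b) *ₛ F (a +ℕ b) ≈⟨ *ₛ-assoc (prodₛ a F) (G b) (F (a +ℕ b)) ⟩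
  prodₛ a F *ₛ G (suc b)           ∎
  where
  open ≋-Reasoning
  G : ℕ → FPS
  G k = prodₛ k (λ i → F (a +ℕ i))

prodₛ-head : ∀ n (F : ℕ → FPS) → prodₛ (suc n) F ≋ F 0 *ₛ prodₛ n (F ∘ suc)
prodₛ-head n F = ≋-trans (prodₛ-+ 1 n F) (*ₛ-congʳ (prodₛ n (F ∘ suc)) (*ₛ-identityˡ (F 0)))

prodₛ-swap : ∀ a b (F : ℕ → ℕ → FPS) →
  prodₛ a (λ r → prodₛ b (F r)) ≋ prodₛ b (λ i → prodₛ a (λ r → F r i))
prodₛ-swap zero    b F = ≋-sym (prodₛ-one b)
prodₛ-swap (suc a) b F = begin
  prodₛ a (λ r → prodₛ b (F r)) *ₛ prodₛ b (F a)
    ≈⟨ *ₛ-congʳ (prodₛ b (F a)) (prodₛ-swap a b F) ⟩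
  prodₛ b (λ i → prodₛ a (λ r → F r i)) *ₛ prodₛ b (F a)
    ≈⟨ prodₛ-distrib b (λ i → prodₛ a (λ r → F r i)) (F a) ⟨
  prodₛ b (λ i → prodₛ (suc a) (λ r → F r i))
    ∎
  where open ≋-Reasoning

prodₛ-blocks : ∀ K m (F : ℕ → FPS) →
  prodₛ (K *ℕ m) F ≋ prodₛ K (λ i → prodₛ m (λ r → F (i *ℕ m +ℕ r)))
prodₛ-blocks zero    m F = ≋-refl
prodₛ-blocks (suc K) m F = begin
  prodₛ (m +ℕ K *ℕ m) F                  ≡⟨ cong (λ n → prodₛ n F) (ℕ.+-comm m _) ⟩
  prodₛ (K *ℕ m +ℕ m) F                  ≈⟨ prodₛ-+ (K *ℕ m) m F ⟩
  prodₛ (K *ℕ m) F *ₛ Fₖ                 ≈⟨ *ₛ-congʳ Fₖ (prodₛ-blocks K m F) ⟩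
  prodₛ (suc K) (λ i → prodₛ m (λ r → F (i *ℕ m +ℕ r)))  ∎
  where
  open ≋-Reasoning
  Fₖ = prodₛ m (λ r → F (K *ℕ m +ℕ r))

poch-factor : ∀ a b i → oneₛ -ₛ mono a *ₛ powₛ (mono b) i ≋ 1-q^ (a +ℕ b *ℕ i)
poch-factor a b i .coeff≡ n =
  cong (oneₛ n -ℤ_)
       (≋-trans (*ₛ-congˡ (mono a) (powₛ-mono b i)) (mono-*ₛ-mono a (b *ℕ i)) .coeff≡ n)

poch-constant : ∀ A Q K → A 0 ≡ + 0 → poch A Q K 0 ≡ + 1
poch-constant A Q K A₀≡0 =
  prodₛ-constant K (λ i → cong (λ a → + 1 -ℤ (+ 0 +ℤ a *ℤ powₛ Q i 0)) A₀≡0)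

-- Sorting the factors 1 - q^k of (q;q)_{Km} by the residue of k - 1 modulo m.
poch-dissect : ∀ m K →
  prodₛ m (λ r → poch (mono (suc r)) (mono m) K) ≋ poch (mono 1) (mono 1) (K *ℕ m)
poch-dissect m K = begin
  prodₛ m (λ r → prodₛ K (λ i → oneₛ -ₛ mono (suc r) *ₛ powₛ (mono m) i))
    ≈⟨ prodₛ-swap m K (λ r i → oneₛ -ₛ mono (suc r) *ₛ powₛ (mono m) i) ⟩
  prodₛ K (λ i → prodₛ m (λ r → oneₛ -ₛ mono (suc r) *ₛ powₛ (mono m) i))
    ≈⟨ prodₛ-cong K (λ i → prodₛ-cong m (λ r → poch-factor (suc r) m i)) ⟩
  prodₛ K (λ i → prodₛ m (λ r → 1-q^ (suc r +ℕ m *ℕ i)))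
    ≈⟨ prodₛ-cong K (λ i → prodₛ-cong m (λ r → ≡⇒≋ (cong 1-q^_ (exponent i r)))) ⟩
  prodₛ K (λ i → prodₛ m (λ r → 1-q^ (1 +ℕ 1 *ℕ (i *ℕ m +ℕ r))))
    ≈⟨ prodₛ-cong K (λ i → prodₛ-cong m (λ r → poch-factor 1 1 (i *ℕ m +ℕ r))) ⟨
  prodₛ K (λ i → prodₛ m (λ r → oneₛ -ₛ mono 1 *ₛ powₛ (mono 1) (i *ℕ m +ℕ r)))
    ≈⟨ prodₛ-blocks K m (λ k → oneₛ -ₛ mono 1 *ₛ powₛ (mono 1) k) ⟨
  poch (mono 1) (mono 1) (K *ℕ m)
    ∎
  where
  open ≋-Reasoning
  exponent : ∀ i r → suc r +ℕ m *ℕ i ≡ 1 +ℕ 1 *ℕ (i *ℕ m +ℕ r)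
  exponent i r = cong suc (trans (ℕ.+-comm r (m *ℕ i))
                          (trans (cong (_+ℕ r) (ℕ.*-comm m i)) (sym (ℕ.*-identityˡ _))))

-- The telescoping sum

-- denominator m n u c = ∏_{r=1}^{u} (q^r;q^m)_{n+1} · ∏_{r=u+1}^{u+c} (q^r;q^m)_n, so that
-- term m (n + 1) j = q^{m(n+1)-j} / denominator m n (m - j) (j - 1) holds definitionally.
denominator : ℕ → ℕ → ℕ → ℕ → FPS
denominator m n u c =
  prodₛ u (λ i → poch (mono (suc i)) (mono m) (suc n)) *ₛ
  prodₛ c (λ i → poch (mono (u +ℕ suc i)) (mono m) n)

denominator-constant : ∀ m n u c → denominator m n u c 0 ≡ + 1
denominator-constant m n u c =
  trans (*ₛ-constant (prodₛ u _) (prodₛ c _))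
        (cong₂ _*ℤ_
          (prodₛ-constant u (λ i → poch-constant (mono (suc i)) (mono m) (suc n) refl))
          (prodₛ-constant c (λ i → poch-constant (mono (u +ℕ suc i)) (mono m) n
                                                 (mono-≢ (0≢u+1+i i)))))
  where
  0≢u+1+i : ∀ i → 0 ≢ u +ℕ suc i
  0≢u+1+i i 0≡u+1+i = ℕ.0≢1+n (trans 0≡u+1+i (ℕ.+-suc u i))

-- (q^{u+1};q^m)_{n+1} = (q^{u+1};q^m)_n (1 - q^{u+1+mn})
denominator-promote : ∀ m n u c →
  denominator m n (suc u) c ≋ denominator m n u (suc c) *ₛ 1-q^ (suc u +ℕ m *ℕ n)
denominator-promote m n u c = begin
  (P *ₛ (X *ₛ φ)) *ₛ R
    ≈⟨ solve 4 (λ p x y r → (p ⊕ (x ⊕ y)) ⊕ r ⊜ (p ⊕ (x ⊕ r)) ⊕ y) ≋-refl P X φ R ⟩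
  (P *ₛ (X *ₛ R)) *ₛ φ
    ≈⟨ *ₛ-cong (*ₛ-congˡ P (≋-sym split-first)) (poch-factor (suc u) m n) ⟩
  (P *ₛ prodₛ (suc c) B) *ₛ 1-q^ (suc u +ℕ m *ℕ n)
    ∎
  where
  open ≋-Reasoning
  open *ₛ-Solver
  P = prodₛ u (λ i → poch (mono (suc i)) (mono m) (suc n))
  X = poch (mono (suc u)) (mono m) n
  φ = oneₛ -ₛ mono (suc u) *ₛ powₛ (mono m) n
  R = prodₛ c (λ i → poch (mono (suc u +ℕ suc i)) (mono m) n)
  B = λ i → poch (mono (u +ℕ suc i)) (mono m) n
  split-first : prodₛ (suc c) B ≋ X *ₛ R
  split-first = ≋-trans (prodₛ-head c B)
    (*ₛ-cong (≡⇒≋ (cong (λ a → poch (mono a) (mono m) n) (ℕ.+-comm u 1)))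
             (prodₛ-cong c (λ i → ≡⇒≋ (cong (λ a → poch (mono a) (mono m) n)
                                            (ℕ.+-suc u (suc i))))))

inv-telescope-step : ∀ X Y e → X 0 ≡ + 1 → Y 0 ≡ + 1 → X ≋ Y *ₛ 1-q^ e →
  mono e *ₛ inv X +ₛ inv Y ≋ inv X
inv-telescope-step X Y e X₀≡1 Y₀≡1 X≋Y*[1-qᵉ] = begin
  mono e *ₛ inv X +ₛ inv Y              ≈⟨ +ₛ-cong (≋-refl {mono e *ₛ inv X}) inv-Y ⟩
  mono e *ₛ inv X +ₛ 1-q^ e *ₛ inv X    ≈⟨ *ₛ-distribʳ-+ₛ (mono e) (1-q^ e) (inv X) ⟨
  (mono e +ₛ 1-q^ e) *ₛ inv X           ≈⟨ *ₛ-congʳ (inv X) (mono+1-q^≋one e) ⟩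
  oneₛ *ₛ inv X                         ≈⟨ *ₛ-identityˡ (inv X) ⟩
  inv X                                 ∎
  where
  open ≋-Reasoning
  inv-Y : inv Y ≋ 1-q^ e *ₛ inv X
  inv-Y = f*g≋h⇒inv-f≋g*inv-h Y (1-q^ e) X Y₀≡1 X₀≡1 (≋-sym X≋Y*[1-qᵉ])

inv-telescope : ∀ k (E : ℕ → FPS) (e : ℕ → ℕ) → (∀ c → E c 0 ≡ + 1) →
  (∀ c → c < k → E c ≋ E (suc c) *ₛ 1-q^ (e c)) →
  sumₛ k (λ c → mono (e c) *ₛ inv (E c)) +ₛ inv (E k) ≋ inv (E 0)
inv-telescope zero    E e E₀≡1 step = mk≋ λ n → ℤ.+-identityˡ (inv (E 0) n)
inv-telescope (suc k) E e E₀≡1 step = begin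
  (S +ₛ mono (e k) *ₛ inv (E k)) +ₛ inv (E (suc k))
    ≈⟨ +ₛ-assoc S (mono (e k) *ₛ inv (E k)) (inv (E (suc k))) ⟩
  S +ₛ (mono (e k) *ₛ inv (E k) +ₛ inv (E (suc k)))
    ≈⟨ +ₛ-cong (≋-refl {S}) (inv-telescope-step (E k) (E (suc k)) (e k)
                                (E₀≡1 k) (E₀≡1 (suc k)) (step k ℕ.≤-refl)) ⟩
  S +ₛ inv (E k)
    ≈⟨ inv-telescope k E e E₀≡1 (λ c c<k → step c (ℕ.m<n⇒m<1+n c<k)) ⟩
  inv (E 0)
    ∎
  where
  open ≋-Reasoning
  S = sumₛ k (λ c → mono (e c) *ₛ inv (E c))

partialDenominator : ℕ → ℕ → FPS
partialDenominator m′ K = prodₛ m′ (λ i → poch (mono (suc i)) (mono (suc m′)) K)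

-- Along c = 0, …, m′ the denominator of term m (n + 1) (c + 1) passes from
-- partialDenominator m′ (n + 1) to partialDenominator m′ n, one factor at a time.
block-sum : ∀ m′ n →
  sumₛ m′ (λ c → term (suc m′) (suc n) (suc c)) +ₛ inv (partialDenominator m′ n)
    ≋ inv (partialDenominator m′ (suc n))
block-sum m′ n = begin
  sumₛ m′ (λ c → term m (suc n) (suc c)) +ₛ inv (partialDenominator m′ n)
    ≈⟨ +ₛ-cong (sumₛ-cong m′ term≋) (inv-cong last≋) ⟩
  sumₛ m′ (λ c → mono (e c) *ₛ inv (E c)) +ₛ inv (E m′)
    ≈⟨ inv-telescope m′ E e (λ c → denominator-constant m n (m′ ∸ c) c) step ⟩
  inv (E 0)
    ≈⟨ inv-cong (*ₛ-identityʳ (partialDenominator m′ (suc n))) ⟩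
  inv (partialDenominator m′ (suc n))
    ∎
  where
  open ≋-Reasoning
  m = suc m′
  E : ℕ → FPS
  E c = denominator m n (m′ ∸ c) c
  e : ℕ → ℕ
  e c = m′ ∸ c +ℕ m *ℕ n
  last≋ : partialDenominator m′ n ≋ E m′
  last≋ = ≋-trans (≋-sym (*ₛ-identityˡ (partialDenominator m′ n)))
                  (≡⇒≋ (cong (λ u → denominator m n u m′) (sym (ℕ.n∸n≡0 m′))))
  term≋ : ∀ c → c < m′ → term m (suc n) (suc c) ≋ mono (e c) *ₛ inv (E c)
  term≋ c c<m′ = *ₛ-congʳ (inv (E c)) (≡⇒≋ (cong mono
    (trans (cong (_∸ suc c) (ℕ.*-suc m n)) (ℕ.+-∸-comm (m *ℕ n) (ℕ.m≤n⇒m≤1+n c<m′)))))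
  step : ∀ c → c < m′ → E c ≋ E (suc c) *ₛ 1-q^ (e c)
  step c c<m′ = subst (λ u → denominator m n u c ≋ E (suc c) *ₛ 1-q^ (u +ℕ m *ℕ n))
                      (sym (ℕ.+-∸-assoc 1 c<m′))
                      (denominator-promote m n (m′ ∸ suc c) c)

partialLHS≋inv-partialDenominator : ∀ m′ K →
  partialLHS (suc m′) K ≋ inv (partialDenominator m′ K)
partialLHS≋inv-partialDenominator m′ zero = begin
  partialLHS (suc m′) 0          ≈⟨ mk≋ (λ n → ℤ.+-identityʳ (oneₛ n)) ⟩
  oneₛ                           ≈⟨ inv-one ⟨
  inv oneₛ                       ≈⟨ inv-cong (prodₛ-one m′) ⟨
  inv (partialDenominator m′ 0)  ∎
  where open ≋-Reasoning
partialLHS≋inv-partialDenominator m′ (suc K) = begin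
  oneₛ +ₛ (sumₛ K F +ₛ F K)
    ≈⟨ +ₛ-assoc oneₛ (sumₛ K F) (F K) ⟨
  partialLHS (suc m′) K +ₛ F K
    ≈⟨ +ₛ-cong (partialLHS≋inv-partialDenominator m′ K) (≋-refl {F K}) ⟩
  inv (partialDenominator m′ K) +ₛ F K
    ≈⟨ +ₛ-comm (inv (partialDenominator m′ K)) (F K) ⟩
  F K +ₛ inv (partialDenominator m′ K)
    ≈⟨ block-sum m′ K ⟩
  inv (partialDenominator m′ (suc K))
    ∎
  where
  open ≋-Reasoning
  F : ℕ → FPS
  F n = sumₛ m′ (λ c → term (suc m′) (suc n) (suc c))

partialLHS-closed-form : ∀ m′ K → partialLHS (suc m′) K ≋
  poch (mono (suc m′)) (mono (suc m′)) K *ₛ inv (poch (mono 1) (mono 1) (K *ℕ suc m′))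
partialLHS-closed-form m′ K =
  ≋-trans (partialLHS≋inv-partialDenominator m′ K)
          (f*g≋h⇒inv-f≋g*inv-h (partialDenominator m′ K) qᵐ-poch q-poch
            (prodₛ-constant m′ (λ i → poch-constant (mono (suc i)) (mono (suc m′)) K refl))
            (poch-constant (mono 1) (mono 1) (K *ℕ suc m′) refl)
            (poch-dissect (suc m′) K))
  where
  qᵐ-poch = poch (mono (suc m′)) (mono (suc m′)) K
  q-poch  = poch (mono 1) (mono 1) (K *ℕ suc m′)

-- The identity holds for every m ≥ 1; the hypothesis 2 ≤ m only serves to exclude m = 0.
corollary1p10 : (m : ℕ) → 2 ≤ m → (A B : FPS) →
    Tendsto (λ K → poch (mono m) (mono m) K) A →
    Tendsto (λ K → poch (mono 1) (mono 1) K) B →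
    Tendsto (partialLHS m) (A *ₛ inv B)
corollary1p10 zero    ()
corollary1p10 (suc m′) _ A B qᵐ-poch→A q-poch→B =
  tendsto-cong (λ K → ≋-sym (partialLHS-closed-form m′ K))
    (tendsto-*ₛ qᵐ-poch→A
      (tendsto-inv
        (tendsto-reindex (λ K → K *ℕ suc m′) (λ K → ℕ.m≤m*n K (suc m′)) q-poch→B)))
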